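{- Let $G$ be a finite simple connected graph of order $n\ge 4$ and size $m$. If $G$ has $k$ pairwise edge-disjoint perfect matchings $M_1,\dots,M_k$ and, with $M=M_1\cup\cdots\cup M_k$, the graph $G\setminus M$ (vertex set $V(G)$, edge set $E(G)\setminus M$) is a connected spanning subgraph of $G$, then $\chi'_L(G)\le m-\frac{kn}{2}+k$.
   Context: For a proper edge coloring $c:E(G)\to\{1,\dots,k\}$ of $G$, let $\pi=(\mathcal{C}_1,\dots,\mathcal{C}_k)$ be the ordered partition of $E(G)$ into color classes. For a vertex $v$ and an edge $e=xy$, $d(v,e)=\min\{d(v,x),d(v,y)\}$, and $d(v,\mathcal{C}_i)=\min\{d(v,e): e\in\mathcal{C}_i\}$. The edge color code of $v$ is $c_\pi(v)=(d(v,\mathcal{C}_1),\dots,d(v,\mathcal{C}_k))$. The coloring is an edge-locating coloring if distinct vertices have distinct edge color codes; $\chi'_L(G)$ is the minimum number of colors in an edge-locating coloring of $G$. -}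

module Defs where

open import Data.Nat using (ℕ; zero; suc; _+_; _*_; _≤_; _<ᵇ_)
open import Data.Fin using (Fin; toℕ; _≟_)
open import Data.Bool using (Bool; true; false; _∧_; _∨_; not; if_then_else_)
open import Data.List using (List; []; _∷_; length; filter; concatMap; allFin)
open import Data.Bool.ListAction using (any)
open import Data.Maybe using (Maybe; just; nothing)
open import Data.Product using (Σ; _×_; _,_; ∃)
open import Relation.Binary.PropositionalEquality using (_≡_; _≢_)
open import Relation.Nullary using (¬_)
open import Relation.Nullary.Decidable using (⌊_⌋)

Adj : ℕ → Set
Adj n = Fin n → Fin n → Bool

record Graph (n : ℕ) : Set where
  field
    adj   : Adj n
    sym   : ∀ x y → adj x y ≡ adj y x
    irrefl : ∀ x → adj x x ≡ false
open Graph public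

-- Edge list: each edge {x,y} listed once as (x , y) with toℕ x < toℕ y.
edgesOf : ∀ {n} → Adj n → List (Fin n × Fin n)
edgesOf {n} a = concatMap (λ x → Data.List.map (λ y → (x , y))
                  (filter (λ y → Relation.Nullary.Decidable.T? ((toℕ x <ᵇ toℕ y) ∧ a x y)) (allFin n)))
                  (allFin n)

size : ∀ {n} → Graph n → ℕ
size G = length (edgesOf (adj G))

-- reach a d u v = true iff there is a walk of length ≤ d from u to v,
-- i.e. iff the graph distance d(u,v) ≤ d.
reach : ∀ {n} → Adj n → ℕ → Fin n → Fin n → Bool
reach a zero    u v = ⌊ u ≟ v ⌋
reach {n} a (suc d) u v = reach a d u v ∨ any (λ w → reach a d u w ∧ a w v) (allFin n)

Connected : ∀ {n} → Adj n → Set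
Connected a = ∀ u v → Σ ℕ (λ d → reach a d u v ≡ true)

-- A proper edge coloring with K colours: a colour for every ordered pair,
-- symmetric on edges; only the values on edges matter.
record ProperEdgeColoring {n} (G : Graph n) (K : ℕ) : Set where
  field
    col    : Fin n → Fin n → Fin K
    colSym : ∀ x y → adj G x y ≡ true → col x y ≡ col y x
    proper : ∀ x y z → adj G x y ≡ true → adj G x z ≡ true → y ≢ z → col x y ≢ col x z
open ProperEdgeColoring public

-- hitsWithin G c d v i = true iff d(v, C_i) ≤ d, i.e. some edge xy of colour i
-- has min(d(v,x), d(v,y)) ≤ d.
hitsWithin : ∀ {n K} (G : Graph n) → ProperEdgeColoring G K → ℕ → Fin n → Fin K → Bool
hitsWithin G c d v i =
  any (λ e → ⌊ col c (Data.Product.proj₁ e) (Data.Product.proj₂ e) ≟ i ⌋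
             ∧ (reach (adj G) d v (Data.Product.proj₁ e) ∨ reach (adj G) d v (Data.Product.proj₂ e)))
      (edgesOf (adj G))

firstFrom : ℕ → ℕ → (ℕ → Bool) → Maybe ℕ
firstFrom start zero p = nothing
firstFrom start (suc fuel) p = if p start then just start else firstFrom (suc start) fuel p

-- d(v, C_i) : nothing encodes ∞ (empty colour class / unreachable).
-- Every finite distance in a graph on n vertices is < n, so scanning 0..n-1 is exact.
distToClass : ∀ {n K} (G : Graph n) → ProperEdgeColoring G K → Fin n → Fin K → Maybe ℕ
distToClass {n} G c v i = firstFrom 0 n (λ d → hitsWithin G c d v i)

code : ∀ {n K} (G : Graph n) → ProperEdgeColoring G K → Fin n → Fin K → Maybe ℕ
code G c v = λ i → distToClass G c v i

IsEdgeLocating : ∀ {n K} (G : Graph n) → ProperEdgeColoring G K → Set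
IsEdgeLocating {n} G c = ∀ (u v : Fin n) → u ≢ v → Σ _ (λ i → code G c u i ≢ code G c v i)

χ'L≤ : ∀ {n} → Graph n → ℕ → Set
χ'L≤ G B = Σ ℕ (λ K → K ≤ B × Σ (ProperEdgeColoring G K) (λ c → IsEdgeLocating G c))

record IsPerfectMatching {n} (G : Graph n) (M : Adj n) : Set where
  field
    sub    : ∀ x y → M x y ≡ true → adj G x y ≡ true
    msym   : ∀ x y → M x y ≡ M y x
    cover  : ∀ x → Σ (Fin n) (λ y → M x y ≡ true × (∀ z → M x z ≡ true → z ≡ y))

removeMatchings : ∀ {n k} → Graph n → (Fin k → Adj n) → Adj n
removeMatchings {n} {k} G Ms x y = adj G x y ∧ not (any (λ j → Ms j x y) (allFin k))

-- Colour every edge of H = G \ (M₁ ∪ … ∪ Mₖ) with a colour of its own and every edge of Mⱼ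
-- with colour j: this uses |E(H)| + k = m − kn/2 + k colours and is proper because each Mⱼ
-- is a matching. Given distinct u and v, pick a third vertex t. A path in H from u to t leaves
-- {u, v} along an edge xy with x ∈ {u, v} and y ∉ {u, v}. Since xy is alone in its colour
-- class, x is at distance 0 from that class while the other vertex of {u, v} is not.
module Submission where

open import Level using (Level)
open import Data.Bool using (Bool; true; false; _∧_; _∨_; not; if_then_else_)
open import Data.Bool.ListAction using (any; or)
open import Data.Bool.Properties
  using (∧-conicalˡ; ∧-conicalʳ; ∧-zeroʳ; ∧-identityʳ; ∨-zeroʳ; T-≡)
  renaming (_≟_ to _≟ᵇ_)
open import Data.Empty using (⊥-elim)
open import Data.Fin using (Fin; zero; suc; toℕ; _≟_; fromℕ<; join; splitAt; punchIn)
open import Data.Fin.Properties using (toℕ-injective; toℕ<n; punchInᵢ≢i; splitAt-join; any?)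
open import Data.List using (List; length; lookup; tabulate; allFin; filter; concatMap; map)
open import Data.List.Properties using (length-++; length-map; map-cong)
open import Data.List.Membership.Propositional using (_∈_; lose; find)
open import Data.List.Membership.Propositional.Properties
  using (∈-allFin; ∈-map⁺; ∈-map⁻; ∈-filter⁺; ∈-filter⁻; ∈-concatMap⁺; ∈-concatMap⁻)
open import Data.List.Relation.Unary.Any using (index)
open import Data.List.Relation.Unary.Any.Properties using (any⁺; any⁻; lookup-index)
open import Data.Maybe using (just)
open import Data.Maybe.Properties using (just-injective)
open import Data.Nat using (ℕ; zero; suc; _+_; _*_; _≤_; _<_; _<ᵇ_; s≤s; z≤n)
open import Data.Nat.Properties
  using (+-*-semiring; +-identityʳ; *-identityʳ; ≤-refl; ≤-trans; ≤-<-trans; n≤1+n)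
open import Data.Nat.Tactic.RingSolver using (solve-∀)
open import Algebra.Properties.Semiring.Sum +-*-semiring
  using (sum-syntax; sum-cong-≗; sum-remove; sum-replicate-zero; ∑-distrib-+; ∑-comm)
open import Data.Product using (Σ; ∃; ∃₂; _×_; _,_; proj₁; proj₂; uncurry)
open import Data.Product.Properties using (≡-dec)
open import Data.Sum using (_⊎_; inj₁; inj₂; [_,_])
open import Data.Sum.Properties using (inj₁-injective; inj₂-injective)
open import Function using (_∘_; Equivalence)
open import Relation.Binary.PropositionalEquality hiding ([_])
open import Relation.Nullary using (Dec; yes; no; ¬_)
open import Relation.Nullary.Decidable using (⌊_⌋; T?; dec-true; isYes≗does; _⊎-dec_)
open import Relation.Unary using (Pred; Decidable)

open import Defs renaming (sym to adj-sym)

private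
  variable
    ℓ : Level
    A B : Set
    n k : ℕ

adj⇒≢ : ∀ (G : Graph n) {x y} → adj G x y ≡ true → x ≢ y
adj⇒≢ G {x} xy refl with () ← trans (sym xy) (irrefl G x)

𝟙 : Bool → ℕ
𝟙 true  = 1
𝟙 false = 0

<ᵇ-flip : ∀ m n → m ≢ n → (m <ᵇ n) ≡ not (n <ᵇ m)
<ᵇ-flip zero    zero    m≢n = ⊥-elim (m≢n refl)
<ᵇ-flip zero    (suc n) _   = refl
<ᵇ-flip (suc m) zero    _   = refl
<ᵇ-flip (suc m) (suc n) m≢n = <ᵇ-flip m n (m≢n ∘ cong suc)

∑-const : ∀ n c → ∑[ i < n ] c ≡ n * c
∑-const zero    c = refl
∑-const (suc n) c = cong (c +_) (∑-const n c)

∑-𝟙-none : (p : Fin n → Bool) → (∀ i → p i ≡ false) → ∑[ i < n ] 𝟙 (p i) ≡ 0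
∑-𝟙-none {n} p none = trans (sum-cong-≗ (cong 𝟙 ∘ none)) (sum-replicate-zero n)

∑-𝟙-unique : (p : Fin n → Bool) → ∀ {j} → p j ≡ true → (∀ i → p i ≡ true → i ≡ j)
           → ∑[ i < n ] 𝟙 (p i) ≡ 1
∑-𝟙-unique {suc n} p {j} pj unique = begin
  ∑[ i < suc n ] 𝟙 (p i)                         ≡⟨ sum-remove (𝟙 ∘ p) ⟩
  𝟙 (p j) + ∑[ i < n ] 𝟙 (p (punchIn j i))      ≡⟨ cong₂ _+_ (cong 𝟙 pj) (∑-𝟙-none _ off-j) ⟩
  1                                              ∎
  where
  open ≡-Reasoning
  off-j : ∀ i → p (punchIn j i) ≡ false
  off-j i with p (punchIn j i) in eq
  ... | false = refl
  ... | true  = ⊥-elim (punchInᵢ≢i j i (unique _ eq))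

length-concatMap-tabulate : ∀ {m} (f : A → List B) (g : Fin m → A)
  → length (concatMap f (tabulate g)) ≡ ∑[ i < m ] length (f (g i))
length-concatMap-tabulate {m = zero}  f g = refl
length-concatMap-tabulate {m = suc m} f g =
  trans (length-++ (f (g zero))) (cong (length (f (g zero)) +_) (length-concatMap-tabulate f (g ∘ suc)))

length-filter-tabulate : ∀ {m} (p : A → Bool) (g : Fin m → A)
  → length (filter (T? ∘ p) (tabulate g)) ≡ ∑[ i < m ] 𝟙 (p (g i))
length-filter-tabulate {m = zero}  p g = refl
length-filter-tabulate {m = suc m} p g with p (g zero)
... | true  = cong suc (length-filter-tabulate p (g ∘ suc))
... | false = length-filter-tabulate p (g ∘ suc)

upperAdj : Adj n → Fin n → Fin n → Bool
upperAdj a x y = (toℕ x <ᵇ toℕ y) ∧ a x y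

edgeCount : Adj n → ℕ
edgeCount {n} a = ∑[ x < n ] ∑[ y < n ] 𝟙 (upperAdj a x y)

module _ (a : Adj n) where

  length-edgesOf : length (edgesOf a) ≡ edgeCount a
  length-edgesOf = trans (length-concatMap-tabulate (λ x → map (x ,_) (upperNeighbours x)) (λ x → x))
    (sum-cong-≗ λ x → trans (length-map (x ,_) (upperNeighbours x))
                             (length-filter-tabulate (upperAdj a x) (λ y → y)))
    where
    upperNeighbours : Fin n → List (Fin n)
    upperNeighbours x = filter (T? ∘ upperAdj a x) (allFin n)

  ∈-edgesOf⁺ : ∀ {x y} → upperAdj a x y ≡ true → (x , y) ∈ edgesOf a
  ∈-edgesOf⁺ {x} {y} xy = ∈-concatMap⁺ _ (lose (∈-allFin x)
    (∈-map⁺ (x ,_) (∈-filter⁺ (T? ∘ upperAdj a x) (∈-allFin y) (Equivalence.from T-≡ xy))))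

  edgesOf⊆adj : ∀ {e} → e ∈ edgesOf a → uncurry a e ≡ true
  edgesOf⊆adj xy∈ with find (∈-concatMap⁻ _ {xs = allFin n} xy∈)
  ... | x , _ , xy∈x with ∈-map⁻ (x ,_) xy∈x
  ... | y , y∈ , refl = ∧-conicalʳ (toℕ x <ᵇ toℕ y) (a x y)
    (Equivalence.to T-≡ (proj₂ (∈-filter⁻ (T? ∘ upperAdj a x) {xs = allFin n} y∈)))

-- The orientation (smaller endpoint first) in which edgesOf lists an edge.
orient : Fin n → Fin n → Fin n × Fin n
orient x y = if toℕ x <ᵇ toℕ y then (x , y) else (y , x)

orient-cases : ∀ (x y : Fin n) → orient x y ≡ (x , y) ⊎ orient x y ≡ (y , x)
orient-cases x y with toℕ x <ᵇ toℕ y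
... | true  = inj₁ refl
... | false = inj₂ refl

orient-comm : ∀ (x y : Fin n) → orient x y ≡ orient y x
orient-comm x y with x ≟ y
... | yes refl = refl
... | no x≢y rewrite <ᵇ-flip (toℕ x) (toℕ y) (x≢y ∘ toℕ-injective) with toℕ y <ᵇ toℕ x
...   | true  = refl
...   | false = refl

orient-invariant : (f : Fin n → Fin n → A) → (∀ x y → f x y ≡ f y x)
  → ∀ x y → uncurry f (orient x y) ≡ f x y
orient-invariant f f-sym x y with orient-cases x y
... | inj₁ eq = cong (uncurry f) eq
... | inj₂ eq = trans (cong (uncurry f) eq) (f-sym y x)

orient-≡⇒∈ : ∀ {u w x y : Fin n} → orient u w ≡ orient x y → u ≡ x ⊎ u ≡ y
orient-≡⇒∈ {u = u} {w} {x} {y} eq with orient-cases u w | orient-cases x y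
... | inj₁ p | inj₁ q = inj₁ (cong proj₁ (trans (sym p) (trans eq q)))
... | inj₁ p | inj₂ q = inj₂ (cong proj₁ (trans (sym p) (trans eq q)))
... | inj₂ p | inj₁ q = inj₂ (cong proj₂ (trans (sym p) (trans eq q)))
... | inj₂ p | inj₂ q = inj₁ (cong proj₂ (trans (sym p) (trans eq q)))

orient-∈-edgesOf : (a : Adj n) → (∀ x y → a x y ≡ a y x) → ∀ {x y} → x ≢ y → a x y ≡ true
  → orient x y ∈ edgesOf a
orient-∈-edgesOf a a-sym {x} {y} x≢y xy with toℕ x <ᵇ toℕ y in x<y
... | true  = ∈-edgesOf⁺ a (cong₂ _∧_ x<y xy)
... | false = ∈-edgesOf⁺ a (cong₂ _∧_ y<x (trans (a-sym y x) xy))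
  where
  y<x : (toℕ y <ᵇ toℕ x) ≡ true
  y<x = trans (<ᵇ-flip (toℕ y) (toℕ x) (x≢y ∘ sym ∘ toℕ-injective)) (cong not x<y)

orient-∈-edgesOf⁻ : (a : Adj n) → (∀ x y → a x y ≡ a y x) → ∀ {x y}
  → orient x y ∈ edgesOf a → a x y ≡ true
orient-∈-edgesOf⁻ a a-sym {x} {y} xy∈ = trans (sym (orient-invariant a a-sym x y)) (edgesOf⊆adj a xy∈)

any-∈⁺ : ∀ (p : A → Bool) {xs x} → x ∈ xs → p x ≡ true → any p xs ≡ true
any-∈⁺ p x∈ px = Equivalence.to T-≡ (any⁺ p (lose x∈ (Equivalence.from T-≡ px)))

any-∈⁻ : ∀ (p : A → Bool) xs → any p xs ≡ true → ∃ λ x → x ∈ xs × p x ≡ true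
any-∈⁻ p xs eq with find (any⁻ p xs (Equivalence.from T-≡ eq))
... | x , x∈ , px = x , x∈ , Equivalence.to T-≡ px

any-allFin⁻ : ∀ (p : Fin n → Bool) → any p (allFin n) ≡ true → ∃ λ i → p i ≡ true
any-allFin⁻ {n} p eq with any-∈⁻ p (allFin n) eq
... | i , _ , pi = i , pi

any-allFin-false : ∀ (p : Fin n → Bool) → any p (allFin n) ≡ false → ∀ i → p i ≡ false
any-allFin-false p none i with p i in pi
... | false = refl
... | true  with () ← trans (sym (any-∈⁺ p (∈-allFin i) pi)) none

𝟙-split-upperAdj : (a : Adj n) → (∀ x y → a x y ≡ a y x) → (∀ x → a x x ≡ false)
  → ∀ x y → 𝟙 (a x y) ≡ 𝟙 (upperAdj a x y) + 𝟙 (upperAdj a y x)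
𝟙-split-upperAdj a a-sym a-irr x y with x ≟ y
... | yes refl rewrite a-irr x | ∧-zeroʳ (toℕ x <ᵇ toℕ x) = refl
... | no x≢y rewrite a-sym y x | <ᵇ-flip (toℕ x) (toℕ y) (x≢y ∘ toℕ-injective)
  with a x y | toℕ y <ᵇ toℕ x
...   | false | true  = refl
...   | false | false = refl
...   | true  | true  = refl
...   | true  | false = refl

handshake : (a : Adj n) → (∀ x y → a x y ≡ a y x) → (∀ x → a x x ≡ false)
  → edgeCount a + edgeCount a ≡ ∑[ x < n ] ∑[ y < n ] 𝟙 (a x y)
handshake {n} a a-sym a-irr = begin
  edgeCount a + edgeCount a
    ≡⟨ cong (edgeCount a +_) (∑-comm (λ y x → 𝟙 (upperAdj a y x))) ⟩
  edgeCount a + ∑[ x < n ] ∑[ y < n ] 𝟙 (upperAdj a y x)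
    ≡⟨ ∑-distrib-+ (λ x → ∑[ y < n ] 𝟙 (upperAdj a x y)) _ ⟨
  ∑[ x < n ] (∑[ y < n ] 𝟙 (upperAdj a x y) + ∑[ y < n ] 𝟙 (upperAdj a y x))
    ≡⟨ sum-cong-≗ (λ x → ∑-distrib-+ (λ y → 𝟙 (upperAdj a x y)) _) ⟨
  ∑[ x < n ] ∑[ y < n ] (𝟙 (upperAdj a x y) + 𝟙 (upperAdj a y x))
    ≡⟨ sum-cong-≗ (λ x → sum-cong-≗ (𝟙-split-upperAdj a a-sym a-irr x)) ⟨
  ∑[ x < n ] ∑[ y < n ] 𝟙 (a x y) ∎
  where open ≡-Reasoning

perfectMatching-size : ∀ (G : Graph n) {M} → IsPerfectMatching G M → edgeCount M + edgeCount M ≡ n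
perfectMatching-size {n} G {M} pm = begin
  edgeCount M + edgeCount M           ≡⟨ handshake M msym M-irr ⟩
  ∑[ x < n ] ∑[ y < n ] 𝟙 (M x y)     ≡⟨ sum-cong-≗ degree-one ⟩
  ∑[ x < n ] 1                        ≡⟨ ∑-const n 1 ⟩
  n * 1                               ≡⟨ *-identityʳ n ⟩
  n                                   ∎
  where
  open ≡-Reasoning
  open IsPerfectMatching pm
  M-irr : ∀ x → M x x ≡ false
  M-irr x with M x x in xx
  ... | false = refl
  ... | true  with () ← trans (sym (sub x x xx)) (irrefl G x)
  degree-one : ∀ x → ∑[ y < n ] 𝟙 (M x y) ≡ 1
  degree-one x with cover x
  ... | y , xy , unique = ∑-𝟙-unique (M x) xy unique

𝟙-partition : (g : Bool) (ms : Fin k → Bool) → (∀ j → ms j ≡ true → g ≡ true)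
  → (∀ i j → i ≢ j → ms i ≡ true → ms j ≡ false)
  → 𝟙 g ≡ 𝟙 (g ∧ not (any ms (allFin k))) + ∑[ j < k ] 𝟙 (ms j)
𝟙-partition {k} g ms ms⊆g disjoint with any ms (allFin k) in some
... | false rewrite ∧-identityʳ g | ∑-𝟙-none ms (any-allFin-false ms some) = sym (+-identityʳ (𝟙 g))
... | true with any-allFin⁻ ms some
...   | j , mj rewrite ms⊆g j mj = sym (∑-𝟙-unique ms mj unique)
  where
  unique : ∀ i → ms i ≡ true → i ≡ j
  unique i mi with i ≟ j
  ... | yes i≡j = i≡j
  ... | no i≢j with () ← trans (sym mj) (disjoint i j i≢j mi)

edgeCount-removeMatchings : (G : Graph n) (Ms : Fin k → Adj n)
  → (∀ j x y → Ms j x y ≡ true → adj G x y ≡ true)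
  → (∀ i j → i ≢ j → ∀ x y → Ms i x y ≡ true → Ms j x y ≡ false)
  → edgeCount (adj G) ≡ edgeCount (removeMatchings G Ms) + ∑[ j < k ] edgeCount (Ms j)
edgeCount-removeMatchings {n} {k} G Ms sub disjoint = begin
  edgeCount (adj G)
    ≡⟨ sum-cong-≗ (λ x → sum-cong-≗ (split x)) ⟩
  ∑[ x < n ] ∑[ y < n ] (𝟙 (upperAdj H x y) + ∑[ j < k ] 𝟙 (upperAdj (Ms j) x y))
    ≡⟨ sum-cong-≗ (λ x → ∑-distrib-+ (λ y → 𝟙 (upperAdj H x y)) _) ⟩
  ∑[ x < n ] (∑[ y < n ] 𝟙 (upperAdj H x y) + ∑[ y < n ] ∑[ j < k ] 𝟙 (upperAdj (Ms j) x y))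
    ≡⟨ ∑-distrib-+ (λ x → ∑[ y < n ] 𝟙 (upperAdj H x y)) _ ⟩
  edgeCount H + ∑[ x < n ] ∑[ y < n ] ∑[ j < k ] 𝟙 (upperAdj (Ms j) x y)
    ≡⟨ cong (edgeCount H +_) (sum-cong-≗ (λ x → ∑-comm (λ y j → 𝟙 (upperAdj (Ms j) x y)))) ⟩
  edgeCount H + ∑[ x < n ] ∑[ j < k ] ∑[ y < n ] 𝟙 (upperAdj (Ms j) x y)
    ≡⟨ cong (edgeCount H +_) (∑-comm (λ x j → ∑[ y < n ] 𝟙 (upperAdj (Ms j) x y))) ⟩
  edgeCount H + ∑[ j < k ] edgeCount (Ms j) ∎
  where
  open ≡-Reasoning
  H = removeMatchings G Ms
  split : ∀ x y → 𝟙 (upperAdj (adj G) x y) ≡ 𝟙 (upperAdj H x y) + ∑[ j < k ] 𝟙 (upperAdj (Ms j) x y)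
  split x y with toℕ x <ᵇ toℕ y
  ... | true  = 𝟙-partition (adj G x y) (λ j → Ms j x y) (λ j → sub j x y)
                  (λ i j i≢j → disjoint i j i≢j x y)
  ... | false = sym (sum-replicate-zero k)

reach-exits : (a : Adj n) {P : Pred (Fin n) ℓ} → Decidable P → ∀ d {u t}
  → reach a d u t ≡ true → P u → ¬ P t → ∃₂ λ x y → P x × ¬ P y × a x y ≡ true
reach-exits a P? zero {u} {t} ut Pu ¬Pt with u ≟ t
... | yes refl = ⊥-elim (¬Pt Pu)
reach-exits {n} a P? (suc d) {u} {t} ut Pu ¬Pt with reach a d u t in ut′
... | true  = reach-exits a P? d ut′ Pu ¬Pt
... | false with any-allFin⁻ (λ w → reach a d u w ∧ a w t) ut
...   | w , uwt with P? w
...     | yes Pw  = w , t , Pw , ¬Pt , ∧-conicalʳ _ _ uwt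
...     | no  ¬Pw = reach-exits a P? d (∧-conicalˡ _ _ uwt) Pu ¬Pw

avoid-two : 3 ≤ n → (u v : Fin n) → ∃ λ t → t ≢ u × t ≢ v
avoid-two (s≤s (s≤s (s≤s _))) zero          zero          = suc zero       , (λ ()) , (λ ())
avoid-two (s≤s (s≤s (s≤s _))) zero          (suc zero)    = suc (suc zero) , (λ ()) , (λ ())
avoid-two (s≤s (s≤s (s≤s _))) zero          (suc (suc _)) = suc zero       , (λ ()) , (λ ())
avoid-two (s≤s (s≤s (s≤s _))) (suc zero)    zero          = suc (suc zero) , (λ ()) , (λ ())
avoid-two (s≤s (s≤s (s≤s _))) (suc zero)    (suc zero)    = zero           , (λ ()) , (λ ())
avoid-two (s≤s (s≤s (s≤s _))) (suc zero)    (suc (suc _)) = zero           , (λ ()) , (λ ())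
avoid-two (s≤s (s≤s (s≤s _))) (suc (suc _)) zero          = suc zero       , (λ ()) , (λ ())
avoid-two (s≤s (s≤s (s≤s _))) (suc (suc _)) (suc zero)    = zero           , (λ ()) , (λ ())
avoid-two (s≤s (s≤s (s≤s _))) (suc (suc _)) (suc (suc _)) = zero           , (λ ()) , (λ ())

⌊⌋-true : ∀ {A : Set ℓ} (a? : Dec A) → A → ⌊ a? ⌋ ≡ true
⌊⌋-true a? a = trans (isYes≗does a?) (dec-true a? a)

firstFrom-sound : ∀ s f p {d} → firstFrom s f p ≡ just d → p d ≡ true
firstFrom-sound s (suc f) p eq with p s in ps
... | true  = subst (λ d → p d ≡ true) (just-injective eq) ps
... | false = firstFrom-sound (suc s) f p eq

firstFrom-0 : ∀ f p → 0 < f → p 0 ≡ true → firstFrom 0 f p ≡ just 0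
firstFrom-0 (suc f) p _ p0 rewrite p0 = refl

module _ {n K} (G : Graph n) (c : ProperEdgeColoring G K) where

  SoleEdgeOfColour : Fin n → Fin n → Set
  SoleEdgeOfColour x y = ∀ u w → adj G u w ≡ true → col c u w ≡ col c x y → u ≡ x ⊎ u ≡ y

  incident-hits : ∀ {u w v} → (u , w) ∈ edgesOf (adj G) → v ≡ u ⊎ v ≡ w
    → hitsWithin G c 0 v (col c u w) ≡ true
  incident-hits {u} {w} {v} uw v∈uw =
    any-∈⁺ _ uw (cong₂ _∧_ (⌊⌋-true (col c u w ≟ col c u w) refl) (endpoint v∈uw))
    where
    endpoint : v ≡ u ⊎ v ≡ w → (⌊ v ≟ u ⌋ ∨ ⌊ v ≟ w ⌋) ≡ true
    endpoint (inj₁ v≡u) = cong (_∨ _) (⌊⌋-true (v ≟ u) v≡u)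
    endpoint (inj₂ v≡w) = trans (cong (⌊ v ≟ u ⌋ ∨_) (⌊⌋-true (v ≟ w) v≡w)) (∨-zeroʳ _)

  code-endpoint : ∀ {x y} → adj G x y ≡ true → code G c x (col c x y) ≡ just 0
  code-endpoint {x} {y} xy = firstFrom-0 n _ (≤-<-trans z≤n (toℕ<n x)) (hits (orient-cases x y))
    where
    xy∈ : orient x y ∈ edgesOf (adj G)
    xy∈ = orient-∈-edgesOf (adj G) (adj-sym G) (adj⇒≢ G xy) xy
    hits : orient x y ≡ (x , y) ⊎ orient x y ≡ (y , x) → hitsWithin G c 0 x (col c x y) ≡ true
    hits (inj₁ eq) = incident-hits (subst (_∈ _) eq xy∈) (inj₁ refl)
    hits (inj₂ eq) = subst (λ i → hitsWithin G c 0 x i ≡ true) (sym (colSym c x y xy))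
                       (incident-hits (subst (_∈ _) eq xy∈) (inj₂ refl))

  code≡0⇒incident : ∀ {v i} → code G c v i ≡ just 0
    → ∃₂ λ u w → adj G u w ≡ true × col c u w ≡ i × (v ≡ u ⊎ v ≡ w)
  code≡0⇒incident {v} {i} eq with any-∈⁻ _ (edgesOf (adj G)) (firstFrom-sound 0 n _ eq)
  ... | (u , w) , uw∈ , hit = u , w , edgesOf⊆adj (adj G) uw∈ , incident hit
    where
    incident : (⌊ col c u w ≟ i ⌋ ∧ (⌊ v ≟ u ⌋ ∨ ⌊ v ≟ w ⌋)) ≡ true
      → col c u w ≡ i × (v ≡ u ⊎ v ≡ w)
    incident hit with col c u w ≟ i | v ≟ u | v ≟ w
    ... | yes uw-i | yes v≡u | _       = uw-i , inj₁ v≡u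
    ... | yes uw-i | no _    | yes v≡w = uw-i , inj₂ v≡w

  sole-edge-separates : ∀ {x y v} → adj G x y ≡ true → SoleEdgeOfColour x y → v ≢ x → v ≢ y
    → code G c x (col c x y) ≢ code G c v (col c x y)
  sole-edge-separates xy sole v≢x v≢y same with code≡0⇒incident (trans (sym same) (code-endpoint xy))
  ... | u , w , uw , uw-col , inj₁ refl = [ v≢x , v≢y ] (sole u w uw uw-col)
  ... | u , w , uw , uw-col , inj₂ refl =
    [ v≢x , v≢y ] (sole w u (trans (adj-sym G w u) uw) (trans (sym (colSym c u w uw)) uw-col))

  connected-sole-edges⇒edgeLocating : 3 ≤ n → (F : Adj n) → Connected F
    → (∀ {x y} → F x y ≡ true → adj G x y ≡ true × SoleEdgeOfColour x y) → IsEdgeLocating G c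
  connected-sole-edges⇒edgeLocating 3≤n F connected sole-edges u v u≢v
    with avoid-two 3≤n u v
  ... | t , t≢u , t≢v with connected u t
  ... | d , ut with reach-exits F (λ z → (z ≟ u) ⊎-dec (z ≟ v)) d ut (inj₁ refl) [ t≢u , t≢v ]
  ... | x , y , x∈uv , y∉uv , Fxy with sole-edges Fxy | x∈uv
  ...   | xy , sole | inj₁ refl =
    col c x y , sole-edge-separates xy sole (u≢v ∘ sym) (y∉uv ∘ inj₂ ∘ sym)
  ...   | xy , sole | inj₂ refl =
    col c x y , sole-edge-separates xy sole u≢v (y∉uv ∘ inj₁ ∘ sym) ∘ sym

join-injective : ∀ m n {a b : Fin m ⊎ Fin n} → join m n a ≡ join m n b → a ≡ b
join-injective m n {a} {b} eq =
  trans (sym (splitAt-join m n a)) (trans (cong (splitAt m) eq) (splitAt-join m n b))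

module RainbowComplement {n k} (G : Graph n) (Ms : Fin k → Adj n) (0<k : 0 < k)
  (pm : ∀ j → IsPerfectMatching G (Ms j))
  (disjoint : ∀ i j → i ≢ j → ∀ x y → Ms i x y ≡ true → Ms j x y ≡ false) where

  open import Data.List.Membership.DecPropositional (≡-dec (_≟_ {n}) (_≟_ {n})) using (_∈?_)
  open IsPerfectMatching using (sub; msym; cover)

  H : Adj n
  H = removeMatchings G Ms

  sizeH : ℕ
  sizeH = length (edgesOf H)

  H⊆G : ∀ {x y} → H x y ≡ true → adj G x y ≡ true
  H⊆G = ∧-conicalˡ _ _

  H-sym : ∀ x y → H x y ≡ H y x
  H-sym x y = cong₂ _∧_ (adj-sym G x y)
    (cong (not ∘ or) (map-cong (λ j → msym (pm j) x y) (allFin k)))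

  matching-unique : ∀ {i j x y} → Ms i x y ≡ true → Ms j x y ≡ true → i ≡ j
  matching-unique {i} {j} {x} {y} mi mj with i ≟ j
  ... | yes i≡j = i≡j
  ... | no  i≢j with () ← trans (sym mj) (disjoint i j i≢j x y mi)

  matching⇒∉H : ∀ {j x y} → Ms j x y ≡ true → H x y ≡ false
  matching⇒∉H {j} {x} {y} m
    rewrite any-∈⁺ (λ j → Ms j x y) (∈-allFin j) m = ∧-zeroʳ (adj G x y)

  edge-classify : ∀ {x y} → adj G x y ≡ true → H x y ≡ true ⊎ ∃ λ j → Ms j x y ≡ true
  edge-classify {x} {y} xy with any (λ j → Ms j x y) (allFin k) in some
  ... | false = inj₁ (cong (_∧ true) xy)
  ... | true  = inj₂ (any-allFin⁻ (λ j → Ms j x y) some)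

  matchingOf : Fin n → Fin n → Fin k
  matchingOf x y with any? (λ j → Ms j x y ≟ᵇ true)
  ... | yes (j , _) = j
  ... | no  _       = fromℕ< 0<k  -- junk: only reached on pairs that lie in no Mⱼ

  matchingOf-correct : ∀ {j x y} → Ms j x y ≡ true → matchingOf x y ≡ j
  matchingOf-correct {j} {x} {y} m with any? (λ j → Ms j x y ≟ᵇ true)
  ... | yes (j′ , m′) = matching-unique m′ m
  ... | no  none      = ⊥-elim (none (j , m))

  keyColour : Fin n × Fin n → Fin sizeH ⊎ Fin k
  keyColour e with e ∈? edgesOf H
  ... | yes e∈H = inj₁ (index e∈H)
  ... | no  _   = inj₂ (uncurry matchingOf e)

  keyColour-inj₁ : ∀ {e i} → keyColour e ≡ inj₁ i → lookup (edgesOf H) i ≡ e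
  keyColour-inj₁ {e} eq with e ∈? edgesOf H
  ... | yes e∈H rewrite sym (inj₁-injective eq) = sym (lookup-index e∈H)

  keyColour-H : ∀ {x y} → H x y ≡ true → ∃ λ i → keyColour (orient x y) ≡ inj₁ i
  keyColour-H {x} {y} xy with orient x y ∈? edgesOf H
  ... | yes e∈H = index e∈H , refl
  ... | no  e∉H = ⊥-elim (e∉H (orient-∈-edgesOf H H-sym (adj⇒≢ G (H⊆G xy)) xy))

  keyColour-M : ∀ {j x y} → Ms j x y ≡ true → keyColour (orient x y) ≡ inj₂ j
  keyColour-M {j} {x} {y} m with orient x y ∈? edgesOf H
  ... | yes e∈H with () ← trans (sym (orient-∈-edgesOf⁻ H H-sym e∈H)) (matching⇒∉H m)
  ... | no  _   = cong inj₂ (matchingOf-correct (trans (orient-invariant (Ms j) (msym (pm j)) x y) m))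

  keyColour-clash : ∀ {x y u w} → adj G x y ≡ true → adj G u w ≡ true
    → keyColour (orient x y) ≡ keyColour (orient u w)
    → orient x y ≡ orient u w ⊎ ∃ λ j → Ms j x y ≡ true × Ms j u w ≡ true
  keyColour-clash {x} {y} {u} {w} xy uw same with edge-classify xy | edge-classify uw
  ... | inj₁ Hxy | _ with keyColour-H Hxy
  ...   | i , xy-i = inj₁ (trans (sym (keyColour-inj₁ xy-i)) (keyColour-inj₁ (trans (sym same) xy-i)))
  keyColour-clash xy uw same | inj₂ (j , Mxy) | inj₁ Huw with keyColour-H Huw
  ...   | i , uw-i with () ← trans (sym (keyColour-M Mxy)) (trans same uw-i)
  keyColour-clash xy uw same | inj₂ (j , Mxy) | inj₂ (j′ , Muw) =
    inj₂ (j , Mxy , subst (λ j → Ms j _ _ ≡ true) j′≡j Muw)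
    where
    j′≡j : j′ ≡ j
    j′≡j = inj₂-injective (trans (sym (keyColour-M Muw)) (trans (sym same) (keyColour-M Mxy)))

  colour : Fin n → Fin n → Fin (sizeH + k)
  colour x y = join sizeH k (keyColour (orient x y))

  colour-proper : ∀ x y z → adj G x y ≡ true → adj G x z ≡ true → y ≢ z → colour x y ≢ colour x z
  colour-proper x y z xy xz y≢z same with keyColour-clash xy xz (join-injective sizeH k same)
  ... | inj₁ eq = [ adj⇒≢ G xy ∘ sym , y≢z ] (orient-≡⇒∈ (trans (orient-comm y x) eq))
  ... | inj₂ (j , Mxy , Mxz) with cover (pm j) x
  ...   | _ , _ , partner = y≢z (trans (partner y Mxy) (sym (partner z Mxz)))

  colouring : ProperEdgeColoring G (sizeH + k)
  colouring = record
    { col    = colour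
    ; colSym = λ x y _ → cong (join sizeH k ∘ keyColour) (orient-comm x y)
    ; proper = colour-proper
    }

  H-edges-sole : ∀ {x y} → H x y ≡ true → adj G x y ≡ true × SoleEdgeOfColour G colouring x y
  H-edges-sole {x} {y} Hxy = H⊆G Hxy , sole
    where
    sole : SoleEdgeOfColour G colouring x y
    sole u w uw same with keyColour-clash uw (H⊆G Hxy) (join-injective sizeH k same)
    ... | inj₁ eq = orient-≡⇒∈ eq
    ... | inj₂ (j , _ , Mxy) with () ← trans (sym Hxy) (matching⇒∉H Mxy)

  colour-count : 2 * (sizeH + k) + k * n ≡ 2 * size G + 2 * k
  colour-count = begin
    2 * (sizeH + k) + k * n                  ≡⟨ cong (2 * (sizeH + k) +_) matchings-cover ⟨
    2 * (sizeH + k) + (|M| + |M|)            ≡⟨ regroup sizeH |M| k ⟩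
    2 * (sizeH + |M|) + 2 * k                ≡⟨ cong (λ m → 2 * m + 2 * k) size-split ⟨
    2 * size G + 2 * k                       ∎
    where
    open ≡-Reasoning
    regroup : ∀ a b c → 2 * (a + c) + (b + b) ≡ 2 * (a + b) + 2 * c
    regroup = solve-∀
    |M| : ℕ
    |M| = ∑[ j < k ] edgeCount (Ms j)
    size-split : size G ≡ sizeH + |M|
    size-split = trans (length-edgesOf (adj G))
      (trans (edgeCount-removeMatchings G Ms (sub ∘ pm) disjoint)
             (cong (_+ |M|) (sym (length-edgesOf H))))
    matchings-cover : |M| + |M| ≡ k * n
    matchings-cover = trans (sym (∑-distrib-+ (edgeCount ∘ Ms) (edgeCount ∘ Ms)))
      (trans (sum-cong-≗ (λ j → perfectMatching-size G (pm j))) (∑-const k n))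

theorem15 : (n : ℕ) (G : Graph n) → 4 ≤ n → Connected (adj G)
    → (k : ℕ) → 1 ≤ k → (Ms : Fin k → Adj n)
    → (∀ j → IsPerfectMatching G (Ms j))
    → (∀ i j → i ≢ j → ∀ x y → Ms i x y ≡ true → Ms j x y ≡ false)
    → Connected (removeMatchings G Ms)
    → Σ ℕ (λ B → (2 * B + k * n ≡ 2 * size G + 2 * k) × χ'L≤ G B)
theorem15 n G 4≤n _ k 1≤k Ms pm disjoint H-connected =
  sizeH + k , colour-count ,
  sizeH + k , ≤-refl , colouring ,
  connected-sole-edges⇒edgeLocating G colouring (≤-trans (n≤1+n 3) 4≤n) H H-connected H-edges-sole
  where open RainbowComplement G Ms 1≤k pm disjoint
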